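{- For all positive integers $M,n$, $Y'(M,n)=(M-1)^n$, where $Y'(M,n)=\min_{H,f}|Z(H,M,f)|$ with $H$ ranging over all hypergraphs on $[n]$ (not necessarily inclusion-free) and $f$ ranging over all strictly increasing functions $f:[M]\to\mathbb{R}_{\ge 0}$.
   Context: A hypergraph on $[n]$ is a set of subsets (edges) of $[n]$ (the empty set may be an edge). For $w:[n]\to[M]$ let $fw(e)=\sum_{i\in e}f(w(i))$; $w$ is isolating for $H,f$ if exactly one edge of $H$ attains the minimum of $fw$ over $H$ (if $H$ has no edges, every $w$ is isolating). $Z(H,M,f)$ is the set of isolating $w\in[M]^n$.
   Formalization: The strictly increasing functions f take nonnegative rational values instead of values in $\mathbb{R}_{\ge 0}$. -}

module Defs where

open import Data.Nat as ℕ using (ℕ)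
open import Data.Bool using (Bool; true; false; if_then_else_)
open import Data.Fin as Fin using (Fin)
open import Data.Fin.Subset using (Subset)
open import Data.Vec using (Vec; []; _∷_)
open import Data.List using (List; length)
open import Data.List.Membership.Propositional using (_∈_)
open import Data.List.Relation.Unary.Unique.Propositional using (Unique)
open import Data.Rational as ℚ using (ℚ; 0ℚ)
open import Data.Product using (Σ; _×_)
open import Data.Sum using (_⊎_)
open import Relation.Nullary using (¬_)
open import Relation.Binary.PropositionalEquality using (_≡_; _≢_)
open import Function.Bundles using (_⇔_)
open import Level using (0ℓ)
open import Relation.Unary using (Pred)

Hypergraph : ℕ → Set₁
Hypergraph n = Pred (Subset n) 0ℓ

-- Weight assignments w : [n] → [M], as vectors (w ∈ [M]^n); [M] is Fin M (order-preserving shift).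
Weighting : ℕ → ℕ → Set
Weighting M n = Vec (Fin M) n

fw : ∀ {M n} → (Fin M → ℚ) → Weighting M n → Subset n → ℚ
fw f []       []       = 0ℚ
fw f (x ∷ w) (b ∷ e)  = (if b then f x else 0ℚ) ℚ.+ fw f w e

Isolating : ∀ {M n} → Hypergraph n → (Fin M → ℚ) → Weighting M n → Set
Isolating {M} {n} H f w =
  (∀ e → ¬ H e) ⊎
  Σ (Subset n) (λ e → H e × (∀ e′ → H e′ → e′ ≢ e → fw f w e ℚ.< fw f w e′))

ZCard : ∀ M n → Hypergraph n → (Fin M → ℚ) → ℕ → Set
ZCard M n H f k =
  Σ (List (Weighting M n)) λ L →
    Unique L × (∀ w → (w ∈ L) ⇔ Isolating H f w) × length L ≡ k

Admissible : ∀ M → (Fin M → ℚ) → Set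
Admissible M f = (∀ i j → i Fin.< j → f i ℚ.< f j) × (∀ i → 0ℚ ℚ.≤ f i)

{-# OPTIONS --safe #-}
module Submission where

-- Write M = m + 1 and let raise : [m]^n → [M]^n add one to every weight.
-- Lower bound: for v ∈ [m]^n pick an edge e minimising fw for raise v, and subtract one
-- from the weights on e.  An edge e′ with e ⊈ e′ loses less than e does (f is strictly
-- increasing), and an edge e′ ⊋ e pays the weights of e′ ∖ e, which are positive; so e
-- becomes the unique minimum.  Two distinct edges cannot both be the unique minimum of
-- one weighting, so v is recovered from the lowered weighting, and we obtain m^n distinct
-- isolating weightings.
-- Upper bound: take all subsets as edges and f = toℕ, so the least weight costs 0.  If no
-- weight is the least one then ∅ is the unique minimum; otherwise toggling such a coordinate
-- in a minimum edge gives another minimum edge.  So Z consists of the m^n raised weightings.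

open import Defs
open import Algebra.Bundles using (CommutativeMonoid)
open import Data.Bool as Bool using (Bool; if_then_else_; not)
open import Data.Bool.Properties using (not-¬)
open import Data.Empty using (⊥-elim)
open import Data.Fin using (Fin; zero; suc; inject₁; toℕ; funToFin; finToFun; combine)
open import Data.Fin.Properties
  using (funToFin-finToFin; finToFun-funToFin; injective⇒≤; suc-injective; inject₁-injective; ≤̄⇒inject₁<)
open import Data.Fin.Subset using (Subset; inside; outside; _⊆_; _⊈_) renaming (⊥ to ∅)
open import Data.Fin.Subset.Properties using (anySubset?; _⊆?_; ⊆-refl; ⊥⊆; drop-∷-⊆; out⊆; in⊆in)
open import Data.List as List using (length)
import Data.List.Properties as ListP
open import Data.List.Membership.Propositional using (_∈_)
open import Data.List.Membership.Propositional.Properties using (∈-tabulate⁺; ∈-tabulate⁻)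
open import Data.List.Membership.Setoid.Properties using (index-injective)
import Data.List.Relation.Unary.Any as Any
open import Data.List.Relation.Unary.Unique.Propositional.Properties using (tabulate⁺)
open import Data.Nat as ℕ using (ℕ; zero; suc; _≤_; _∸_; _^_; _>_; z<s; s≤s)
import Data.Nat.Properties as ℕP
open import Data.Product using (Σ; _×_; _,_; proj₁; proj₂; ∃; ∃-syntax)
open import Data.Rational as ℚ using (ℚ; 0ℚ; 1ℚ; _+_)
import Data.Rational.Properties as ℚP
open import Data.Sum using (_⊎_; inj₁; inj₂; [_,_])
open import Data.Unit using (⊤; tt)
open import Data.Vec as Vec using (Vec; []; _∷_; here)
import Data.Vec.Properties as VecP
open import Effect.Monad using (RawMonad)
open import Function using (_∘_; id; Injective)
open import Function.Bundles using (Equivalence; mk⇔)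
open import Level using (0ℓ)
open import Relation.Binary.PropositionalEquality
  using (_≡_; _≢_; _≗_; refl; sym; trans; cong; cong₂; subst; subst₂; setoid; module ≡-Reasoning)
open import Relation.Nullary using (¬_; yes; no; contradiction)
open import Relation.Nullary.Decidable using (decidable-stable; ¬¬-excluded-middle)
open import Relation.Nullary.Negation using (DoubleNegation; ¬¬-Monad; ¬¬-map)
open import Relation.Unary using (Pred; Decidable)
open import Algebra.Properties.CommutativeSemigroup
  (CommutativeMonoid.commutativeSemigroup ℚP.+-0-commutativeMonoid) using (interchange)

+-cancelˡ-< : ∀ c {a b} → c + a ℚ.< c + b → a ℚ.< b
+-cancelˡ-< c c+a<c+b = ℚP.≰⇒> λ b≤a → ℚP.<-irrefl refl (ℚP.<-≤-trans c+a<c+b (ℚP.+-monoʳ-≤ c b≤a))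

+-cancelʳ-< : ∀ c {a b} → a + c ℚ.< b + c → a ℚ.< b
+-cancelʳ-< c a+c<b+c = ℚP.≰⇒> λ b≤a → ℚP.<-irrefl refl (ℚP.<-≤-trans a+c<b+c (ℚP.+-monoˡ-≤ c b≤a))

funToFin-cong : ∀ {m n} {g h : Fin m → Fin n} → g ≗ h → funToFin g ≡ funToFin h
funToFin-cong {zero}  _   = refl
funToFin-cong {suc m} g≗h = cong₂ combine (g≗h zero) (funToFin-cong (g≗h ∘ suc))

vecOf : ∀ {m n} → Fin (m ^ n) → Vec (Fin m) n
vecOf = Vec.tabulate ∘ finToFun

vecOf-injective : ∀ {m n} → Injective _≡_ _≡_ (vecOf {m} {n})
vecOf-injective {m} {n} {i} {j} vecOf-i≡vecOf-j = begin
  i                                   ≡⟨ funToFin-finToFin {n} {m} i ⟨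
  funToFin (finToFun {m} {n} i)       ≡⟨ funToFin-cong finToFun-i≗finToFun-j ⟩
  funToFin (finToFun {m} {n} j)       ≡⟨ funToFin-finToFin {n} {m} j ⟩
  j                                   ∎
  where
  open ≡-Reasoning
  finToFun-i≗finToFun-j : finToFun i ≗ finToFun j
  finToFun-i≗finToFun-j x = begin
    finToFun i x               ≡⟨ VecP.lookup∘tabulate (finToFun i) x ⟨
    Vec.lookup (vecOf i) x     ≡⟨ cong (λ v → Vec.lookup v x) vecOf-i≡vecOf-j ⟩
    Vec.lookup (vecOf j) x     ≡⟨ VecP.lookup∘tabulate (finToFun j) x ⟩
    finToFun j x               ∎

vecOf-funToFin-lookup : ∀ {m n} (v : Vec (Fin m) n) → vecOf (funToFin (Vec.lookup v)) ≡ v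
vecOf-funToFin-lookup v =
  trans (VecP.tabulate-cong (finToFun-funToFin (Vec.lookup v))) (VecP.tabulate∘lookup v)

module _ {M n} {H : Hypergraph n} {f : Fin M → ℚ} where

  isolating-injection⇒≤ : ∀ {N k} → ZCard M n H f k →
    (G : Fin N → Weighting M n) → Injective _≡_ _≡_ G → (∀ i → Isolating H f (G i)) → N ≤ k
  isolating-injection⇒≤ {N} (L , _ , members , refl) G G-injective G-isolating =
    injective⇒≤ position-injective
    where
    position : Fin N → Fin (length L)
    position i = Any.index (Equivalence.from (members (G i)) (G-isolating i))
    position-injective : Injective _≡_ _≡_ position
    position-injective eq = G-injective (index-injective (setoid _) _ _ eq)

  isolating-enumeration⇒ZCard : ∀ {N} (G : Fin N → Weighting M n) → Injective _≡_ _≡_ G →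
    (∀ w → Isolating H f w → ∃[ i ] w ≡ G i) → (∀ i → Isolating H f (G i)) → ZCard M n H f N
  isolating-enumeration⇒ZCard G G-injective enumerates G-isolating =
    List.tabulate G , tabulate⁺ G-injective , (λ w → mk⇔ (sound w) (complete w)) ,
    ListP.length-tabulate G
    where
    sound : ∀ w → w ∈ List.tabulate G → Isolating H f w
    sound w w∈G with ∈-tabulate⁻ w∈G
    ... | i , refl = G-isolating i
    complete : ∀ w → Isolating H f w → w ∈ List.tabulate G
    complete w isolating with enumerates w isolating
    ... | i , refl = ∈-tabulate⁺ i

module _ {M} (f : Fin M → ℚ) where

  fw-mono-⊆ : (∀ x → 0ℚ ℚ.≤ f x) → ∀ {n} (w : Weighting M n) {e e′} → e ⊆ e′ →
              fw f w e ℚ.≤ fw f w e′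
  fw-mono-⊆ f≥0 []      {[]}          {[]}           _    = ℚP.≤-refl
  fw-mono-⊆ f≥0 (x ∷ w) {outside ∷ e} {outside ∷ e′} e⊆e′ =
    ℚP.+-monoʳ-≤ 0ℚ (fw-mono-⊆ f≥0 w (drop-∷-⊆ e⊆e′))
  fw-mono-⊆ f≥0 (x ∷ w) {outside ∷ e} {inside ∷ e′}  e⊆e′ =
    ℚP.+-mono-≤ (f≥0 x) (fw-mono-⊆ f≥0 w (drop-∷-⊆ e⊆e′))
  fw-mono-⊆ f≥0 (x ∷ w) {inside ∷ e}  {inside ∷ e′}  e⊆e′ =
    ℚP.+-monoʳ-≤ (f x) (fw-mono-⊆ f≥0 w (drop-∷-⊆ e⊆e′))
  fw-mono-⊆ f≥0 (x ∷ w) {inside ∷ e}  {outside ∷ e′} e⊆e′ = contradiction (e⊆e′ here) λ ()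

IsMinimum : ∀ {n} → Pred (Subset n) 0ℓ → (Subset n → ℚ) → Subset n → Set
IsMinimum P g e = P e × (∀ e′ → P e′ → g e ℚ.≤ g e′)

minimum-or-empty : ∀ {n} {P : Pred (Subset n) 0ℓ} → Decidable P → (g : Subset n → ℚ) →
  (∀ e → ¬ P e) ⊎ ∃ (IsMinimum P g)
minimum-or-empty {zero} P? g with P? []
... | yes P[] = inj₂ ([] , P[] , λ { [] _ → ℚP.≤-refl })
... | no ¬P[] = inj₁ λ { [] → ¬P[] }
minimum-or-empty {suc n} P? g
  with minimum-or-empty (P? ∘ (outside ∷_)) (g ∘ (outside ∷_))
     | minimum-or-empty (P? ∘ (inside ∷_)) (g ∘ (inside ∷_))
... | inj₁ ∄₀ | inj₁ ∄₁ = inj₁ λ { (outside ∷ e) → ∄₀ e ; (inside ∷ e) → ∄₁ e }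
... | inj₂ (e₀ , P₀ , min₀) | inj₁ ∄₁ =
  inj₂ (outside ∷ e₀ , P₀ , λ { (outside ∷ e) → min₀ e ; (inside ∷ e) Pe → contradiction Pe (∄₁ e) })
... | inj₁ ∄₀ | inj₂ (e₁ , P₁ , min₁) =
  inj₂ (inside ∷ e₁ , P₁ , λ { (outside ∷ e) Pe → contradiction Pe (∄₀ e) ; (inside ∷ e) → min₁ e })
... | inj₂ (e₀ , P₀ , min₀) | inj₂ (e₁ , P₁ , min₁) with ℚP.≤-total (g (outside ∷ e₀)) (g (inside ∷ e₁))
...   | inj₁ g₀≤g₁ =
  inj₂ (outside ∷ e₀ , P₀ , λ { (outside ∷ e) → min₀ e ; (inside ∷ e) Pe → ℚP.≤-trans g₀≤g₁ (min₁ e Pe) })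
...   | inj₂ g₁≤g₀ =
  inj₂ (inside ∷ e₁ , P₁ , λ { (outside ∷ e) Pe → ℚP.≤-trans g₁≤g₀ (min₀ e Pe) ; (inside ∷ e) → min₁ e })

minimum : ∀ {n} {P : Pred (Subset n) 0ℓ} → Decidable P → ∃ P → (g : Subset n → ℚ) → ∃ (IsMinimum P g)
minimum P? (e , Pe) g = [ (λ ∄P → contradiction Pe (∄P e)) , id ] (minimum-or-empty P? g)

¬¬-decidable : ∀ {n} (P : Pred (Subset n) 0ℓ) → DoubleNegation (Decidable P)
¬¬-decidable {zero} P = do
  P[]? ← ¬¬-excluded-middle
  pure λ { [] → P[]? }
  where open RawMonad ¬¬-Monad
¬¬-decidable {suc n} P = do
  P₀? ← ¬¬-decidable (P ∘ (outside ∷_))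
  P₁? ← ¬¬-decidable (P ∘ (inside ∷_))
  pure λ { (outside ∷ e) → P₀? e ; (inside ∷ e) → P₁? e }
  where open RawMonad ¬¬-Monad

lowerAt : ∀ {m} → Bool → Fin m → Fin (suc m)
lowerAt inside  = inject₁
lowerAt outside = suc

lowerAt-injective : ∀ {m} b {x y : Fin m} → lowerAt b x ≡ lowerAt b y → x ≡ y
lowerAt-injective inside  = inject₁-injective
lowerAt-injective outside = suc-injective

lower : ∀ {m n} → Subset n → Vec (Fin m) n → Weighting (suc m) n
lower = Vec.zipWith lowerAt

raise : ∀ {m n} → Vec (Fin m) n → Weighting (suc m) n
raise = lower ∅

lower-injective : ∀ {m n} (e : Subset n) {v v′ : Vec (Fin m) n} → lower e v ≡ lower e v′ → v ≡ v′
lower-injective []      {[]}    {[]}      _  = refl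
lower-injective (b ∷ e) {x ∷ v} {y ∷ v′} eq =
  cong₂ _∷_ (lowerAt-injective b (VecP.∷-injectiveˡ eq)) (lower-injective e (VecP.∷-injectiveʳ eq))

raise∘vecOf-injective : ∀ {m n} → Injective _≡_ _≡_ (raise {m} {n} ∘ vecOf)
raise∘vecOf-injective eq = vecOf-injective (lower-injective ∅ eq)

module _ {m} {f : Fin (suc m) → ℚ} (adm : Admissible (suc m) f) where

  f-inject₁<f-suc : ∀ x → f (inject₁ x) ℚ.< f (suc x)
  f-inject₁<f-suc x = proj₁ adm _ _ (≤̄⇒inject₁< ℕP.≤-refl)

  0<f-suc : ∀ x → 0ℚ ℚ.< f (suc x)
  0<f-suc x = ℚP.≤-<-trans (proj₂ adm zero) (proj₁ adm zero (suc x) z<s)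

  lower-exchange-head-< : ∀ x → f (inject₁ x) + 0ℚ ℚ.< 0ℚ + f (suc x)
  lower-exchange-head-< x =
    subst₂ ℚ._<_ (sym (ℚP.+-identityʳ _)) (sym (ℚP.+-identityˡ _)) (f-inject₁<f-suc x)

  lower-exchange-head : ∀ b b′ (x : Fin m) →
    (if b then f (lowerAt b x) else 0ℚ) + (if b′ then f (suc x) else 0ℚ) ℚ.≤
    (if b′ then f (lowerAt b x) else 0ℚ) + (if b then f (suc x) else 0ℚ)
  lower-exchange-head outside outside x = ℚP.≤-refl
  lower-exchange-head outside inside  x = ℚP.≤-reflexive (ℚP.+-comm 0ℚ (f (suc x)))
  lower-exchange-head inside  inside  x = ℚP.≤-refl
  lower-exchange-head inside  outside x = ℚP.<⇒≤ (lower-exchange-head-< x)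

  -- _R_ is explicit: it cannot be inferred through the non-injective ℚ._+_.
  lower-exchange-∷ : (_R_ : ℚ → ℚ → Set) → ∀ b b′ x {n} (e e′ : Subset n) (v : Vec (Fin m) n) →
    (((if b then f (lowerAt b x) else 0ℚ) + (if b′ then f (suc x) else 0ℚ)) +
       (fw f (lower e v) e + fw f (raise v) e′)) R
    (((if b′ then f (lowerAt b x) else 0ℚ) + (if b then f (suc x) else 0ℚ)) +
       (fw f (lower e v) e′ + fw f (raise v) e)) →
    (fw f (lower (b ∷ e) (x ∷ v)) (b ∷ e) + fw f (raise (x ∷ v)) (b′ ∷ e′)) R
      (fw f (lower (b ∷ e) (x ∷ v)) (b′ ∷ e′) + fw f (raise (x ∷ v)) (b ∷ e))
  lower-exchange-∷ _R_ b b′ x e e′ v = subst₂ _R_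
    (interchange (head b (lowerAt b x)) (head b′ (suc x)) (fw f (lower e v) e) (fw f (raise v) e′))
    (interchange (head b′ (lowerAt b x)) (head b (suc x)) (fw f (lower e v) e′) (fw f (raise v) e))
    where
    head : Bool → Fin (suc m) → ℚ
    head b y = if b then f y else 0ℚ

  lower-exchange-≤ : ∀ {n} (e e′ : Subset n) (v : Vec (Fin m) n) →
    fw f (lower e v) e + fw f (raise v) e′ ℚ.≤ fw f (lower e v) e′ + fw f (raise v) e
  lower-exchange-≤ []      []        []      = ℚP.≤-refl
  lower-exchange-≤ (b ∷ e) (b′ ∷ e′) (x ∷ v) =
    lower-exchange-∷ ℚ._≤_ b b′ x e e′ v
      (ℚP.+-mono-≤ (lower-exchange-head b b′ x) (lower-exchange-≤ e e′ v))

  lower-exchange-< : ∀ {n} (e e′ : Subset n) (v : Vec (Fin m) n) → e ⊈ e′ →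
    fw f (lower e v) e + fw f (raise v) e′ ℚ.< fw f (lower e v) e′ + fw f (raise v) e
  lower-exchange-< [] [] [] []⊈[] = ⊥-elim ([]⊈[] ⊆-refl)
  lower-exchange-< (inside ∷ e) (outside ∷ e′) (x ∷ v) _ =
    lower-exchange-∷ ℚ._<_ inside outside x e e′ v
      (ℚP.+-mono-<-≤ (lower-exchange-head-< x) (lower-exchange-≤ e e′ v))
  lower-exchange-< (inside ∷ e) (inside ∷ e′) (x ∷ v) e⊈e′ =
    lower-exchange-∷ ℚ._<_ inside inside x e e′ v
      (ℚP.+-mono-≤-< (lower-exchange-head inside inside x)
                     (lower-exchange-< e e′ v (e⊈e′ ∘ in⊆in)))
  lower-exchange-< (outside ∷ e) (b′ ∷ e′) (x ∷ v) e⊈e′ =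
    lower-exchange-∷ ℚ._<_ outside b′ x e e′ v
      (ℚP.+-mono-≤-< (lower-exchange-head outside b′ x)
                     (lower-exchange-< e e′ v (e⊈e′ ∘ out⊆)))

  fw-lower-<-superset : ∀ {n} (e e′ : Subset n) (v : Vec (Fin m) n) → e ⊆ e′ → e ≢ e′ →
    fw f (lower e v) e ℚ.< fw f (lower e v) e′
  fw-lower-<-superset [] [] [] _ []≢[] = contradiction refl []≢[]
  fw-lower-<-superset (outside ∷ e) (outside ∷ e′) (x ∷ v) e⊆e′ e≢e′ =
    ℚP.+-monoʳ-< 0ℚ (fw-lower-<-superset e e′ v (drop-∷-⊆ e⊆e′) (e≢e′ ∘ cong (outside ∷_)))
  fw-lower-<-superset (inside ∷ e) (inside ∷ e′) (x ∷ v) e⊆e′ e≢e′ =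
    ℚP.+-monoʳ-< (f (inject₁ x))
                 (fw-lower-<-superset e e′ v (drop-∷-⊆ e⊆e′) (e≢e′ ∘ cong (inside ∷_)))
  fw-lower-<-superset (outside ∷ e) (inside ∷ e′) (x ∷ v) e⊆e′ _ =
    ℚP.+-mono-<-≤ (0<f-suc x) (fw-mono-⊆ f (proj₂ adm) (lower e v) (drop-∷-⊆ e⊆e′))
  fw-lower-<-superset (inside ∷ e) (outside ∷ e′) _ e⊆e′ _ = contradiction (e⊆e′ here) λ ()

  module _ {n} {H : Hypergraph n} where

    lower-strict-minimum : ∀ {e} (v : Vec (Fin m) n) → IsMinimum H (fw f (raise v)) e →
      ∀ e′ → H e′ → e′ ≢ e → fw f (lower e v) e ℚ.< fw f (lower e v) e′
    lower-strict-minimum {e} v (_ , minimal) e′ He′ e′≢e with e ⊆? e′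
    ... | yes e⊆e′ = fw-lower-<-superset e e′ v e⊆e′ (e′≢e ∘ sym)
    ... | no  e⊈e′ = +-cancelʳ-< (fw f (raise v) e′) (begin-strict
      fw f (lower e v) e + fw f (raise v) e′   <⟨ lower-exchange-< e e′ v e⊈e′ ⟩
      fw f (lower e v) e′ + fw f (raise v) e   ≤⟨ ℚP.+-monoʳ-≤ (fw f (lower e v) e′) (minimal e′ He′) ⟩
      fw f (lower e v) e′ + fw f (raise v) e′  ∎)
      where open ℚP.≤-Reasoning

    lower-isolating : ∀ {e} (v : Vec (Fin m) n) → IsMinimum H (fw f (raise v)) e →
                      Isolating H f (lower e v)
    lower-isolating {e} v minimum = inj₂ (e , proj₁ minimum , lower-strict-minimum v minimum)

    lower-injective-on-minima : ∀ {e e′} {v v′ : Vec (Fin m) n} →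
      IsMinimum H (fw f (raise v)) e → IsMinimum H (fw f (raise v′)) e′ →
      lower e v ≡ lower e′ v′ → v ≡ v′
    lower-injective-on-minima {e} {e′} {v} {v′} minimum minimum′ eq with VecP.≡-dec Bool._≟_ e e′
    ... | yes refl = lower-injective e eq
    ... | no e≢e′  =
      contradiction (lower-strict-minimum v′ minimum′ e (proj₁ minimum) e≢e′) (ℚP.<-asym e<e′)
      where
      e<e′ : fw f (lower e′ v′) e ℚ.< fw f (lower e′ v′) e′
      e<e′ = subst (λ w → fw f w e ℚ.< fw f w e′) eq
                   (lower-strict-minimum v minimum e′ (proj₁ minimum′) (e≢e′ ∘ sym))

    lower-bound-decidable : Decidable H → ∀ {k} → ZCard (suc m) n H f k → m ^ n ≤ k
    lower-bound-decidable H? Z with anySubset? H?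
    ... | no ∄H =
      isolating-injection⇒≤ Z (raise ∘ vecOf) raise∘vecOf-injective (λ _ → inj₁ λ e He → ∄H (e , He))
    ... | yes ∃H = isolating-injection⇒≤ Z G G-injective G-isolating
      where
      minimiser : ∀ v → ∃ (IsMinimum H (fw f (raise v)))
      minimiser v = minimum H? ∃H (fw f (raise v))
      G : Fin (m ^ n) → Weighting (suc m) n
      G i = lower (proj₁ (minimiser (vecOf i))) (vecOf i)
      G-injective : Injective _≡_ _≡_ G
      G-injective {i} {j} eq = vecOf-injective
        (lower-injective-on-minima (proj₂ (minimiser (vecOf i))) (proj₂ (minimiser (vecOf j))) eq)
      G-isolating : ∀ i → Isolating H f (G i)
      G-isolating i = lower-isolating (vecOf i) (proj₂ (minimiser (vecOf i)))

    -- H is an arbitrary predicate, so it is decidable only up to double negation; this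
    -- suffices because the conclusion is a decidable inequality.
    lower-bound : ∀ {k} → ZCard (suc m) n H f k → m ^ n ≤ k
    lower-bound {k} Z =
      decidable-stable (m ^ n ℕ.≤? k) (¬¬-map (λ H? → lower-bound-decidable H? Z) (¬¬-decidable H))

fromℕ : ℕ → ℚ
fromℕ zero    = 0ℚ
fromℕ (suc k) = 1ℚ + fromℕ k

fromℕ-<-suc : ∀ k → fromℕ k ℚ.< fromℕ (suc k)
fromℕ-<-suc k =
  subst (ℚ._< 1ℚ + fromℕ k) (ℚP.+-identityˡ (fromℕ k)) (ℚP.+-monoˡ-< (fromℕ k) (ℚP.positive⁻¹ 1ℚ))

fromℕ-mono-< : ∀ {j k} → j ℕ.< k → fromℕ j ℚ.< fromℕ k
fromℕ-mono-< {j} {suc k} (s≤s j≤k) with ℕP.m≤n⇒m<n∨m≡n j≤k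
... | inj₁ j<k  = ℚP.<-trans (fromℕ-mono-< j<k) (fromℕ-<-suc k)
... | inj₂ refl = fromℕ-<-suc j

fromℕ-nonneg : ∀ k → 0ℚ ℚ.≤ fromℕ k
fromℕ-nonneg zero    = ℚP.≤-refl
fromℕ-nonneg (suc k) = ℚP.<⇒≤ (fromℕ-mono-< (z<s {k}))

fromℕ∘toℕ-admissible : ∀ M → Admissible M (fromℕ ∘ toℕ)
fromℕ∘toℕ-admissible M = (λ i j → fromℕ-mono-<) , (λ i → fromℕ-nonneg (toℕ i))

complete : ∀ {n} → Hypergraph n
complete _ = ⊤

module _ {m} {f : Fin (suc m) → ℚ} (adm : Admissible (suc m) f) (f-zero≡0 : f zero ≡ 0ℚ) where

  raise-isolating : ∀ {n} (v : Vec (Fin m) n) → Isolating complete f (raise v)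
  raise-isolating v = lower-isolating adm v (tt , λ e _ → fw-mono-⊆ f (proj₂ adm) (raise v) ⊥⊆)

  unique-minimum⇒raised : ∀ {n} (w : Weighting (suc m) n) e →
    (∀ e′ → e′ ≢ e → fw f w e ℚ.< fw f w e′) → ∃[ v ] w ≡ raise v
  unique-minimum⇒raised [] [] _ = [] , refl
  unique-minimum⇒raised (zero ∷ w) (b ∷ e) unique =
    contradiction toggled-same (ℚP.<⇒≢ (unique (not b ∷ e) λ eq → not-¬ refl (sym (VecP.∷-injectiveˡ eq))))
    where
    zero-weight : ∀ b → (if b then f zero else 0ℚ) ≡ 0ℚ
    zero-weight inside  = f-zero≡0
    zero-weight outside = refl
    toggled-same : fw f (zero ∷ w) (b ∷ e) ≡ fw f (zero ∷ w) (not b ∷ e)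
    toggled-same = cong (_+ fw f w e) (trans (zero-weight b) (sym (zero-weight (not b))))
  unique-minimum⇒raised (suc y ∷ w) (b ∷ e) unique =
    let v , w≡raise-v = unique-minimum⇒raised w e λ e′ e′≢e →
          +-cancelˡ-< (if b then f (suc y) else 0ℚ) (unique (b ∷ e′) (e′≢e ∘ VecP.∷-injectiveʳ))
    in y ∷ v , cong (suc y ∷_) w≡raise-v

  isolating⇒raised : ∀ {n} (w : Weighting (suc m) n) → Isolating complete f w → ∃[ v ] w ≡ raise v
  isolating⇒raised w (inj₁ ∄edge)            = contradiction tt (∄edge ∅)
  isolating⇒raised w (inj₂ (e , _ , unique)) = unique-minimum⇒raised w e (λ e′ → unique e′ tt)

  upper-bound : ∀ n → ZCard (suc m) n complete f (m ^ n)
  upper-bound n =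
    isolating-enumeration⇒ZCard (raise ∘ vecOf) raise∘vecOf-injective enumerates (raise-isolating ∘ vecOf)
    where
    enumerates : ∀ w → Isolating complete f w → ∃[ i ] w ≡ raise (vecOf i)
    enumerates w isolating with isolating⇒raised w isolating
    ... | v , refl = funToFin (Vec.lookup v) , cong raise (sym (vecOf-funToFin-lookup v))

proposition15 : ∀ M n → M > 0 → n > 0 →
    ((H : Hypergraph n) (f : Fin M → ℚ) → Admissible M f →
       ∀ k → ZCard M n H f k → (M ∸ 1) ^ n ≤ k)
    × Σ (Hypergraph n) (λ H → Σ (Fin M → ℚ) (λ f →
         Admissible M f × ZCard M n H f ((M ∸ 1) ^ n)))
proposition15 zero    n () _
proposition15 (suc m) n _  _ =
  (λ H f admissible k → lower-bound admissible) ,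
  (complete , fromℕ ∘ toℕ , admissible , upper-bound admissible refl n)
  where
  admissible : Admissible (suc m) (fromℕ ∘ toℕ)
  admissible = fromℕ∘toℕ-admissible (suc m)
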